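{- The sentence $\Phi(16)$ is true.
   Context: Define $f:\mathbb{N}\setminus\{0\}\to\mathbb{N}\setminus\{0\}$ by $f(1)=1$, $f(n)=2^{2^{n-2}}$ for $n\in\{2,3,4,5\}$, and $f(n)=\left(2+2^{2^{n-4}}\right)^{2^{n-4}}$ for $n\geqslant 6$. For a positive integer $b$, $\Phi(b)$ is the sentence: for every positive integer $n$ and every system $T\subseteq\{x_i+1=x_k,\ x_i\cdot x_j=x_k:\ i,j,k\in\{1,\ldots,n\}\}$ all of whose solutions $(x_1,\ldots,x_n)$ in positive integers satisfy $x_1,\ldots,x_n\leqslant b$, each such solution satisfies $x_1,\ldots,x_n\leqslant f(n)$. -}

module Defs where

open import Data.Nat using (ℕ; zero; suc; _+_; _*_; _^_; _≤_)
open import Data.Fin using (Fin)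
open import Data.List using (List)
open import Data.List.Membership.Propositional using (_∈_)
open import Relation.Binary.PropositionalEquality using (_≡_)

-- f : N\{0} → N\{0}; the value at 0 is irrelevant (never used, n ≥ 1 in Φ).
f : ℕ → ℕ
f 0 = 1
f 1 = 1
f 2 = 2 ^ (2 ^ 0)
f 3 = 2 ^ (2 ^ 1)
f 4 = 2 ^ (2 ^ 2)
f 5 = 2 ^ (2 ^ 3)
f (suc (suc (suc (suc (suc (suc m)))))) =
  (2 + 2 ^ (2 ^ (suc (suc m)))) ^ (2 ^ (suc (suc m)))   -- n = m+6, n-4 = m+2

data Eqn (n : ℕ) : Set where
  add1 : (i k : Fin n) → Eqn n
  mul  : (i j k : Fin n) → Eqn n

Sat : {n : ℕ} → (Fin n → ℕ) → Eqn n → Set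
Sat x (add1 i k)  = x i + 1 ≡ x k
Sat x (mul i j k) = x i * x j ≡ x k

PosSolution : {n : ℕ} → List (Eqn n) → (Fin n → ℕ) → Set
PosSolution {n} T x = (∀ (i : Fin n) → 1 ≤ x i) × (∀ e → e ∈ T → Sat x e)
  where open import Data.Product using (_×_)

Bounded : {n : ℕ} → (Fin n → ℕ) → ℕ → Set
Bounded {n} x c = ∀ (i : Fin n) → x i ≤ c

Φ : ℕ → Set
Φ b = ∀ (n : ℕ) → 1 ≤ n → (T : List (Eqn n)) →
      (∀ x → PosSolution T x → Bounded x b) →
      ∀ x → PosSolution T x → Bounded x (f n)

-- A positive solution x of T with all entries ≤ 16 either satisfies x ≤ f(n), or it escapes:
-- some positive y satisfies every equation that x satisfies and has an entry above 16.  Such a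
-- y solves T, contradicting the hypothesis that all solutions are ≤ 16.  For n ≥ 4 there is
-- nothing to do, since f(n) ≥ 16; for n ≤ 3 the dichotomy is checked on all of [1, 16]ⁿ, the
-- escaping y being the image of x under a guessed homomorphism σ of its value set.
{-# OPTIONS --safe #-}
module Submission where

open import Defs
open import Data.Bool using (Bool; true; _∧_; if_then_else_; T)
open import Data.Bool.Properties using (T-∧)
open import Data.Empty using (⊥-elim)
open import Data.Fin using (Fin) renaming (zero to fzero; suc to fsuc)
open import Data.Fin.Properties using (all?; any?)
open import Data.Bool.ListAction using (any)
open import Data.List using (List; tabulate; cartesianProduct; findᵇ)
open import Data.Maybe using (just; nothing)
open import Data.Nat using (ℕ; zero; suc; _+_; _*_; _∸_; _^_; _≤_; _<_; _≡ᵇ_; _<ᵇ_; _≟_; _≤?_; _<?_)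
open import Data.Nat.Properties using (≤-refl; ≤-trans; n≤1+n; ≤-pred; ≤∧≢⇒<; <⇒≱; m≤m+n; ^-monoˡ-≤; ^-monoʳ-≤)
open import Data.Product using (_×_; _,_; proj₁; proj₂; ∃; ∃-syntax)
open import Data.Sum using (_⊎_; inj₁; inj₂; [_,_]′)
open import Function using (_∘_; Equivalence)
open import Data.Vec.Functional using (_∷_; tail)
open import Relation.Nullary using (¬_; Dec; yes; no)
open import Relation.Nullary.Decidable using (_×-dec_; _⊎-dec_; _→-dec_; map′; isYes; toWitness)
open import Relation.Binary.PropositionalEquality using (_≡_; refl; sym; trans; cong₂; subst; subst₂; _≗_)

private
  variable
    n : ℕ

Positive : (Fin n → ℕ) → Set
Positive x = ∀ i → 1 ≤ x i

PreservesEqns : (x y : Fin n → ℕ) → Set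
PreservesEqns x y = ∀ e → Sat x e → Sat y e

Exceeds : (Fin n → ℕ) → ℕ → Set
Exceeds y b = ∃[ i ] b < y i

IsEscape : ℕ → (x y : Fin n → ℕ) → Set
IsEscape b x y = Positive y × PreservesEqns x y × Exceeds y b

Escapes : ℕ → (Fin n → ℕ) → Set
Escapes b x = ∃ (IsEscape b x)

bounded-solutions⇒¬escapes : ∀ {b} {x : Fin n → ℕ} (S : List (Eqn n)) →
  (∀ y → PosSolution S y → Bounded y b) → PosSolution S x → ¬ Escapes b x
bounded-solutions⇒¬escapes S bound (_ , solves) (y , pos , pres , i , b<yi) =
  <⇒≱ b<yi (bound y (pos , λ e e∈S → pres e (solves e e∈S)) i)

bounded-unless-escapes : ∀ {b c} →
  (∀ (x : Fin n → ℕ) → Positive x → Bounded x b → Bounded x c ⊎ Escapes b x) →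
  (S : List (Eqn n)) → (∀ y → PosSolution S y → Bounded y b) →
  ∀ x → PosSolution S x → Bounded x c
bounded-unless-escapes dichotomy S bound x sol with dichotomy x (proj₁ sol) (bound x sol)
... | inj₁ bounded = bounded
... | inj₂ escape  = ⊥-elim (bounded-solutions⇒¬escapes S bound sol escape)

sat-resp : ∀ {x x′ : Fin n → ℕ} → x ≗ x′ → ∀ e → Sat x e → Sat x′ e
sat-resp x≗x′ (add1 i k)  s = subst₂ (λ a c → a + 1 ≡ c) (x≗x′ i) (x≗x′ k) s
sat-resp x≗x′ (mul i j k) s = trans (sym (cong₂ _*_ (x≗x′ i) (x≗x′ j))) (trans s (x≗x′ k))

escapes-resp : ∀ {b} {x x′ : Fin n → ℕ} → x ≗ x′ → Escapes b x → Escapes b x′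
escapes-resp x≗x′ (y , pos , pres , exceeds) =
  y , pos , (λ e s → pres e (sat-resp (sym ∘ x≗x′) e s)) , exceeds

bounded-resp : ∀ {c} {x x′ : Fin n → ℕ} → x ≗ x′ → Bounded x c → Bounded x′ c
bounded-resp x≗x′ bounded i = subst (_≤ _) (x≗x′ i) (bounded i)

sat? : (x : Fin n → ℕ) → ∀ e → Dec (Sat x e)
sat? x (add1 i k)  = x i + 1 ≟ x k
sat? x (mul i j k) = x i * x j ≟ x k

preservesEqns? : (x y : Fin n → ℕ) → Dec (PreservesEqns x y)
preservesEqns? x y =
  map′ fromIndices toIndices
    (all? λ i → all? λ k → preserves? (add1 i k) ×-dec all? λ j → preserves? (mul i j k))
  where
  preserves? : ∀ e → Dec (Sat x e → Sat y e)
  preserves? e = sat? x e →-dec sat? y e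
  Indexed : Set
  Indexed = ∀ i k → (Sat x (add1 i k) → Sat y (add1 i k))
                  × (∀ j → Sat x (mul i j k) → Sat y (mul i j k))
  fromIndices : Indexed → PreservesEqns x y
  fromIndices p (add1 i k)  = proj₁ (p i k)
  fromIndices p (mul i j k) = proj₂ (p i k) j
  toIndices : PreservesEqns x y → Indexed
  toIndices p i k = p (add1 i k) , λ j → p (mul i j k)

isEscape? : ∀ b (x y : Fin n → ℕ) → Dec (IsEscape b x y)
isEscape? b x y = all? (λ i → 1 ≤? y i) ×-dec preservesEqns? x y ×-dec any? (λ i → b <? y i)

bounded? : (x : Fin n → ℕ) → ∀ c → Dec (Bounded x c)
bounded? x c = all? λ i → x i ≤? c

-- σ guesses a homomorphism of the partial structure (V, 1, +1, ·) formed by the values V of x: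
-- 1 is fixed, a successor or a product of values in V goes to the successor or product of
-- their images, a value one below such a product to that product minus one, and any other
-- value to fresh.  Recursive calls are on smaller values, so fuel b suffices on [1, b].
-- Nothing about σ is proved: the exhaustive search checks every lift it produces.
liftValue : (fresh fuel : ℕ) → List ℕ → ℕ → ℕ
liftValue fresh zero      V v = fresh
liftValue fresh (suc fuel) V v =
  if v ≡ᵇ 1 then 1
  else if any (_≡ᵇ (v ∸ 1)) V then σ (v ∸ 1) + 1
  else if-factor v (λ u w → σ u * σ w)
    (if-factor (suc v) (λ u w → σ u * σ w ∸ 1) fresh)
  where
  σ : ℕ → ℕ
  σ = liftValue fresh fuel V
  if-factor : ℕ → (ℕ → ℕ → ℕ) → ℕ → ℕ
  if-factor m found otherwise
    with findᵇ (λ (u , w) → (1 <ᵇ u) ∧ (1 <ᵇ w) ∧ (u * w ≡ᵇ m)) (cartesianProduct V V)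
  ... | just (u , w) = found u w
  ... | nothing      = otherwise

liftOf : ℕ → (Fin n → ℕ) → (Fin n → ℕ)
liftOf b x i = liftValue (suc b) b (tabulate x) (x i)

allUpTo : ℕ → (ℕ → Bool) → Bool
allUpTo zero    p = true
allUpTo (suc b) p = p (suc b) ∧ allUpTo b p

allUpTo-sound : ∀ b p {a} → T (allUpTo b p) → 1 ≤ a → a ≤ b → T (p a)
allUpTo-sound zero    p {suc a} all 1≤a ()
allUpTo-sound (suc b) p {a} all 1≤a a≤b with a ≟ suc b
... | yes refl = proj₁ (Equivalence.to T-∧ all)
... | no a≢b   = allUpTo-sound b p (proj₂ (Equivalence.to T-∧ all)) 1≤a (≤-pred (≤∧≢⇒< a≤b a≢b))

InBox : ℕ → (Fin n → ℕ) → Set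
InBox b x = Positive x × Bounded x b

allInBox : ∀ n → ℕ → ((Fin n → ℕ) → Bool) → Bool
allInBox zero    b p = p (λ ())
allInBox (suc n) b p = allUpTo b λ a → allInBox n b (λ xs → p (a ∷ xs))

allInBox-sound : ∀ n b p → T (allInBox n b p) → ∀ x → InBox b x → ∃[ x′ ] x′ ≗ x × T (p x′)
allInBox-sound zero    b p all x _ = (λ ()) , (λ ()) , all
allInBox-sound (suc n) b p all x (pos , bounded)
  with allInBox-sound n b (λ xs → p (x fzero ∷ xs))
         (allUpTo-sound b _ all (pos fzero) (bounded fzero)) (tail x) (pos ∘ fsuc , bounded ∘ fsuc)
... | x′ , x′≗tail , px = x fzero ∷ x′ , (λ { fzero → refl ; (fsuc i) → x′≗tail i }) , px

boundedOrLifts? : ∀ b c (x : Fin n → ℕ) → Dec (Bounded x c ⊎ IsEscape b x (liftOf b x))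
boundedOrLifts? b c x = bounded? x c ⊎-dec isEscape? b x (liftOf b x)

escapes-by-search : ∀ n b c → T (allInBox n b (isYes ∘ boundedOrLifts? b c)) →
  ∀ (x : Fin n → ℕ) → Positive x → Bounded x b → Bounded x c ⊎ Escapes b x
escapes-by-search n b c all x pos bounded with allInBox-sound n b _ all x (pos , bounded)
... | x′ , x′≗x , found =
  [ inj₁ ∘ bounded-resp x′≗x , (λ lifts → inj₂ (escapes-resp x′≗x (_ , lifts))) ]′
    (toWitness {a? = boundedOrLifts? b c x′} found)

16≤f[4+m] : ∀ m → 16 ≤ f (4 + m)
16≤f[4+m] zero          = ≤-refl
16≤f[4+m] (suc zero)    = ^-monoʳ-≤ 2 (^-monoʳ-≤ 2 (n≤1+n 2))
16≤f[4+m] (suc (suc m)) =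
  ≤-trans (^-monoʳ-≤ 2 (^-monoʳ-≤ 2 (m≤m+n 2 m))) (^-monoˡ-≤ (2 ^ (2 + m)) (m≤m+n 2 _))

corollary3 : Φ 16
corollary3 zero ()
corollary3 1 _ = bounded-unless-escapes (escapes-by-search 1 16 (f 1) _)
corollary3 2 _ = bounded-unless-escapes (escapes-by-search 2 16 (f 2) _)
corollary3 3 _ = bounded-unless-escapes (escapes-by-search 3 16 (f 3) _)
corollary3 (suc (suc (suc (suc m)))) _ _ bound x sol i = ≤-trans (bound x sol i) (16≤f[4+m] m)
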